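{- Let $M$ be a non-self-intersecting matching on the nodes $1,\dots,n$. Then there exists a binary search tree on the keys $1,\dots,n$ in which, for every edge $\{x,y\}\in M$, the nodes $x$ and $y$ are adjacent (one is the parent of the other).
   Context: A matching on $\{1,\dots,n\}$ is a set of pairwise disjoint unordered pairs of distinct elements. It is non-self-intersecting if for any two of its edges $\{x,y\}$ and $\{z,w\}$ with $x<y$ and $z<w$, the intervals $[x,y]$ and $[z,w]$ either do not overlap or one is a proper subset of the other. -}

module Defs where

open import Data.Nat using (ℕ; suc; _<_; _≤_)
open import Data.Product using (_×_; _,_)
open import Data.Sum using (_⊎_)
open import Data.List using (List; []; _∷_; _++_; map)
open import Data.List.Membership.Propositional using (_∈_)
open import Data.List.Relation.Unary.All using (All)
open import Data.List.Relation.Binary.Permutation.Propositional using (_↭_)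
open import Relation.Binary.PropositionalEquality using (_≡_)
open import Relation.Nullary using (¬_)

-- Matchings on {1,…,n}
-- An edge {x,y} is stored as the ordered pair (x , y) with x < y.

Edge : Set
Edge = ℕ × ℕ

endpoints : Edge → List ℕ
endpoints (x , y) = x ∷ y ∷ []

IsMatching : ℕ → List Edge → Set
IsMatching n M =
  (∀ {x y} → (x , y) ∈ M → 1 ≤ x × x < y × y ≤ n) ×
  (∀ {e f v} → e ∈ M → f ∈ M → v ∈ endpoints e → v ∈ endpoints f → e ≡ f)

NonCrossingPair : Edge → Edge → Set
NonCrossingPair (x , y) (z , w) =
  (y < z ⊎ w < x) ⊎
  ((z ≤ x × y ≤ w × ¬ ((x , y) ≡ (z , w))) ⊎
   (x ≤ z × w ≤ y × ¬ ((z , w) ≡ (x , y))))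

IsNonSelfIntersecting : List Edge → Set
IsNonSelfIntersecting M =
  ∀ {e f} → e ∈ M → f ∈ M → ¬ (e ≡ f) → NonCrossingPair e f

data Tree : Set where
  leaf : Tree
  node : Tree → ℕ → Tree → Tree

keys : Tree → List ℕ
keys leaf = []
keys (node l k r) = keys l ++ (k ∷ keys r)

data IsBST : Tree → Set where
  leaf : IsBST leaf
  node : ∀ {l k r} → IsBST l → IsBST r →
         All (_< k) (keys l) → All (k <_) (keys r) → IsBST (node l k r)

oneTo : ℕ → List ℕ
oneTo 0 = []
oneTo (suc n) = oneTo n ++ (suc n ∷ [])

IsBSTOn : ℕ → Tree → Set
IsBSTOn n t = IsBST t × (keys t ↭ oneTo n)

data RootIs : Tree → ℕ → Set where
  root : ∀ {l k r} → RootIs (node l k r) k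

data Parent : Tree → ℕ → ℕ → Set where
  here-l : ∀ {l k r c} → RootIs l c → Parent (node l k r) k c
  here-r : ∀ {l k r c} → RootIs r c → Parent (node l k r) k c
  in-l   : ∀ {l k r p c} → Parent l p c → Parent (node l k r) p c
  in-r   : ∀ {l k r p c} → Parent r p c → Parent (node l k r) p c

Adjacent : Tree → ℕ → ℕ → Set
Adjacent t x y = Parent t x y ⊎ Parent t y x

-- Build the tree on an interval [a, b) of keys from its left end a. If a has no partner
-- below b, then a is the root, with the tree on [a+1, b) as its right subtree. If a is
-- matched to y < b, then y is the root, its left child is a with the tree on [a+1, y)
-- as right subtree, and its right subtree is the tree on [y+1, b). As the matching is
-- non-crossing, every other edge of the interval lies inside [a+1, y) or inside
-- [y+1, b), so induction makes its endpoints adjacent. The in-order traversal is the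
-- increasing list a, …, b-1, hence the tree is a binary search tree.
module Submission where

open import Defs
open import Data.Nat using (ℕ; zero; suc; _+_; _∸_; _≤_; _<_; s≤s; _≟_; _<?_; _≤?_)
open import Data.Nat.Properties
open import Data.Product using (Σ; ∃; _×_; _,_; proj₁; proj₂)
open import Data.Sum using (_⊎_; inj₁; inj₂)
import Data.Sum as Sum
open import Data.List using (List; []; _∷_; _++_; [_])
open import Data.List.Membership.Propositional using (_∈_; _∉_; find; lose)
open import Data.List.Relation.Unary.Any using (here; there; any?)
open import Data.List.Relation.Unary.All as All using (All; []; _∷_)
import Data.List.Relation.Unary.All.Properties as All
open import Data.List.Relation.Unary.AllPairs using (AllPairs; []; _∷_)
open import Data.List.Relation.Unary.Linked using (Linked; []; [-]; _∷_)
open import Data.List.Relation.Unary.Linked.Properties using (Linked⇒AllPairs)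
open import Data.List.Relation.Binary.Permutation.Propositional using (↭-reflexive)
open import Data.Empty using (⊥; ⊥-elim)
open import Relation.Nullary using (yes; no)
open import Relation.Binary.Definitions using (tri<; tri≈; tri>)
open import Relation.Binary.PropositionalEquality
  using (_≡_; _≢_; refl; sym; trans; cong; cong₂; subst; module ≡-Reasoning)
open ≡-Reasoning

AllPairs-++⁻ : ∀ {A : Set} {R : A → A → Set} xs {ys} → AllPairs R (xs ++ ys) →
               AllPairs R xs × All (λ x → All (R x) ys) xs × AllPairs R ys
AllPairs-++⁻ []       rs       = [] , [] , rs
AllPairs-++⁻ (x ∷ xs) (rx ∷ rs) =
  let rxs , rxys , rys = AllPairs-++⁻ xs rs
  in All.++⁻ˡ xs rx ∷ rxs , All.++⁻ʳ xs rx ∷ rxys , rys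

sorted⇒IsBST : ∀ t → AllPairs _<_ (keys t) → IsBST t
sorted⇒IsBST leaf         _ = leaf
sorted⇒IsBST (node l k r) s with AllPairs-++⁻ (keys l) s
... | sl , l<kr , (k<r ∷ sr) =
  node (sorted⇒IsBST l sl) (sorted⇒IsBST r sr) (All.map All.head l<kr) k<r

adjacent-left : ∀ {l k r x z} → Adjacent l x z → Adjacent (node l k r) x z
adjacent-left = Sum.map in-l in-l

adjacent-right : ∀ {l k r x z} → Adjacent r x z → Adjacent (node l k r) x z
adjacent-right = Sum.map in-r in-r

consecutive : ℕ → ℕ → List ℕ
consecutive a zero    = []
consecutive a (suc k) = a ∷ consecutive (suc a) k

consecutive-++ : ∀ a i j → consecutive a i ++ consecutive (a + i) j ≡ consecutive a (i + j)
consecutive-++ a zero    j = cong (λ c → consecutive c j) (+-identityʳ a)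
consecutive-++ a (suc i) j = cong (a ∷_) (begin
  consecutive (suc a) i ++ consecutive (a + suc i) j
    ≡⟨ cong (λ c → consecutive (suc a) i ++ consecutive c j) (+-suc a i) ⟩
  consecutive (suc a) i ++ consecutive (suc a + i) j
    ≡⟨ consecutive-++ (suc a) i j ⟩
  consecutive (suc a) (i + j) ∎)

consecutive-sorted : ∀ a k → AllPairs _<_ (consecutive a k)
consecutive-sorted a k = Linked⇒AllPairs <-trans (linked a k)
  where
  linked : ∀ a k → Linked _<_ (consecutive a k)
  linked a zero          = []
  linked a (suc zero)    = [-]
  linked a (suc (suc k)) = n<1+n a ∷ linked (suc a) (suc k)

oneTo≡consecutive : ∀ n → oneTo n ≡ consecutive 1 n
oneTo≡consecutive zero    = refl
oneTo≡consecutive (suc n) = begin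
  oneTo n ++ [ suc n ]                      ≡⟨ cong (_++ [ suc n ]) (oneTo≡consecutive n) ⟩
  consecutive 1 n ++ consecutive (1 + n) 1  ≡⟨ consecutive-++ 1 n 1 ⟩
  consecutive 1 (n + 1)                     ≡⟨ cong (consecutive 1) (+-comm n 1) ⟩
  consecutive 1 (suc n)                     ∎

interval : ℕ → ℕ → List ℕ
interval a b = consecutive a (b ∸ a)

interval-empty : ∀ {a b} → b ≤ a → interval a b ≡ []
interval-empty b≤a = cong (consecutive _) (m≤n⇒m∸n≡0 b≤a)

interval-cons : ∀ {a b} → a < b → interval a b ≡ a ∷ interval (suc a) b
interval-cons {a} {suc b} (s≤s a≤b) = cong (consecutive a) (+-∸-assoc 1 a≤b)

interval-++ : ∀ {a y b} → a ≤ y → y ≤ b → interval a y ++ interval y b ≡ interval a b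
interval-++ {a} {y} {b} a≤y y≤b = begin
  consecutive a (y ∸ a) ++ consecutive y (b ∸ y)
    ≡⟨ cong (λ c → consecutive a (y ∸ a) ++ consecutive c (b ∸ y)) (sym (m+[n∸m]≡n a≤y)) ⟩
  consecutive a (y ∸ a) ++ consecutive (a + (y ∸ a)) (b ∸ y)
    ≡⟨ consecutive-++ a (y ∸ a) (b ∸ y) ⟩
  consecutive a ((y ∸ a) + (b ∸ y))
    ≡⟨ cong (consecutive a) lengths ⟩
  consecutive a (b ∸ a) ∎
  where
  lengths : (y ∸ a) + (b ∸ y) ≡ b ∸ a
  lengths = begin
    (y ∸ a) + (b ∸ y) ≡⟨ +-comm (y ∸ a) (b ∸ y) ⟩
    (b ∸ y) + (y ∸ a) ≡⟨ sym (+-∸-assoc (b ∸ y) a≤y) ⟩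
    (b ∸ y) + y ∸ a   ≡⟨ cong (_∸ a) (m∸n+n≡m y≤b) ⟩
    b ∸ a             ∎

interval-sorted : ∀ a b → AllPairs _<_ (interval a b)
interval-sorted a b = consecutive-sorted a (b ∸ a)

module _ {n : ℕ} {M : List Edge} (matching : IsMatching n M) where

  edge-ordered : ∀ {x y} → (x , y) ∈ M → x < y
  edge-ordered m = proj₁ (proj₂ (proj₁ matching m))

  edge-unique : ∀ {e f v} → e ∈ M → f ∈ M → v ∈ endpoints e → v ∈ endpoints f → e ≡ f
  edge-unique = proj₂ matching

  right-partner-unique : ∀ {x y z} → (x , y) ∈ M → (x , z) ∈ M → y ≡ z
  right-partner-unique m m′ = cong proj₂ (edge-unique m m′ (here refl) (here refl))

  left-partner-unique : ∀ {x y z} → (x , z) ∈ M → (y , z) ∈ M → x ≡ y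
  left-partner-unique m m′ = cong proj₁ (edge-unique m m′ (there (here refl)) (there (here refl)))

  right-end-not-left-end : ∀ {x y z} → (x , y) ∈ M → (y , z) ∈ M → ⊥
  right-end-not-left-end m m′ =
    <-irrefl (cong proj₁ (edge-unique m m′ (there (here refl)) (here refl))) (edge-ordered m)

  -- a < x < y < z would be a crossing, and z ≡ y would make y an endpoint of two edges.
  nested : IsNonSelfIntersecting M →
           ∀ {a x y z} → (a , y) ∈ M → (x , z) ∈ M → a < x → x < y → z < y
  nested noncrossing {a} {x} {y} {z} m m′ a<x x<y
    with noncrossing m m′ (λ e → <-irrefl (cong proj₁ e) a<x)
  ... | inj₁ (inj₁ y<x)            = ⊥-elim (<-asym x<y y<x)
  ... | inj₁ (inj₂ z<a)            = ⊥-elim (<-asym (<-trans a<x (edge-ordered m′)) z<a)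
  ... | inj₂ (inj₁ (x≤a , _))      = ⊥-elim (<⇒≱ a<x x≤a)
  ... | inj₂ (inj₂ (_ , z≤y , _)) = ≤∧≢⇒< z≤y z≢y
    where
    z≢y : z ≢ y
    z≢y refl = <-irrefl (left-partner-unique m m′) a<x

partner? : ∀ (M : List Edge) a → (∃ λ y → (a , y) ∈ M) ⊎ (∀ {y} → (a , y) ∉ M)
partner? M a with any? (λ e → proj₁ e ≟ a) M
... | yes has with find has
...   | (_ , y) , m , refl = inj₁ (y , m)
partner? M a | no hasn't = inj₂ λ m → hasn't (lose m refl)

data Split (M : List Edge) (a b : ℕ) : Set where
  empty     : b ≤ a → Split M a b
  unmatched : a < b → (∀ {y} → (a , y) ∈ M → b ≤ y) → Split M a b
  matched   : ∀ {y} → (a , y) ∈ M → a < y → y < b → Split M a b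

split : ∀ {n M} → IsMatching n M → ∀ a b → Split M a b
split {M = M} matching a b with b ≤? a
... | yes b≤a = empty b≤a
... | no b≰a with partner? M a
...   | inj₂ none = unmatched (≰⇒> b≰a) (λ m → ⊥-elim (none m))
...   | inj₁ (y , m) with y <? b
...     | yes y<b = matched m (edge-ordered matching m) y<b
...     | no y≮b  = unmatched (≰⇒> b≰a) (λ m′ → subst (b ≤_) (right-partner-unique matching m m′) (≮⇒≥ y≮b))

fuel-step : ∀ a b {f} → b ∸ a ≤ suc f → b ∸ suc a ≤ f
fuel-step a b {f} h = subst (_≤ f) (pred[m∸n]≡m∸[1+n] b a) (pred-mono-≤ h)

module Construction {M : List Edge} (split : ∀ a b → Split M a b) where

  build : ℕ → ℕ → ℕ → Tree
  buildSplit : ℕ → ∀ {a b} → Split M a b → Tree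
  build zero    a b = leaf
  build (suc f) a b = buildSplit f (split a b)
  buildSplit f (empty _) = leaf
  buildSplit f {a} {b} (unmatched _ _) = node leaf a (build f (suc a) b)
  buildSplit f {a} {b} (matched {y} _ _ _) =
    node (node leaf a (build f (suc a) y)) y (build f (suc y) b)

  module _ {f a b y} (h : b ∸ a ≤ suc f) (a<y : a < y) (y<b : y < b) where
    fuel-left : y ∸ suc a ≤ f
    fuel-left = ≤-trans (∸-monoˡ-≤ (suc a) (<⇒≤ y<b)) (fuel-step a b h)

    fuel-right : b ∸ suc y ≤ f
    fuel-right = ≤-trans (∸-monoʳ-≤ b (s≤s (<⇒≤ a<y))) (fuel-step a b h)

  keys-build : ∀ f {a b} → b ∸ a ≤ f → keys (build f a b) ≡ interval a b
  keys-buildSplit : ∀ f {a b} → b ∸ a ≤ suc f → (s : Split M a b) →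
                    keys (buildSplit f s) ≡ interval a b
  keys-build zero    {a} h = cong (consecutive a) (sym (n≤0⇒n≡0 h))
  keys-build (suc f) {a} {b} h = keys-buildSplit f h (split a b)
  keys-buildSplit f h (empty b≤a) = sym (interval-empty b≤a)
  keys-buildSplit f {a} {b} h (unmatched a<b _) = begin
    a ∷ keys (build f (suc a) b) ≡⟨ cong (a ∷_) (keys-build f (fuel-step a b h)) ⟩
    a ∷ interval (suc a) b       ≡⟨ sym (interval-cons a<b) ⟩
    interval a b                 ∎
  keys-buildSplit f {a} {b} h (matched {y} _ a<y y<b) = begin
    (a ∷ keys (build f (suc a) y)) ++ y ∷ keys (build f (suc y) b)
      ≡⟨ cong₂ (λ l r → (a ∷ l) ++ y ∷ r)
               (keys-build f (fuel-left h a<y y<b)) (keys-build f (fuel-right h a<y y<b)) ⟩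
    (a ∷ interval (suc a) y) ++ y ∷ interval (suc y) b
      ≡⟨ cong₂ _++_ (sym (interval-cons a<y)) (sym (interval-cons y<b)) ⟩
    interval a y ++ interval y b
      ≡⟨ interval-++ (<⇒≤ a<y) (<⇒≤ y<b) ⟩
    interval a b ∎

  module _ {n} (matching : IsMatching n M) (noncrossing : IsNonSelfIntersecting M) where

    nonempty : ∀ {a b x z} → (x , z) ∈ M → a ≤ x → z < b → a < b
    nonempty m a≤x z<b = ≤-<-trans a≤x (<-trans (edge-ordered matching m) z<b)

    build-adjacent : ∀ f {a b} → b ∸ a ≤ f →
                     ∀ {x z} → (x , z) ∈ M → a ≤ x → z < b → Adjacent (build f a b) x z
    buildSplit-adjacent : ∀ f {a b} → b ∸ a ≤ suc f → (s : Split M a b) →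
                          ∀ {x z} → (x , z) ∈ M → a ≤ x → z < b → Adjacent (buildSplit f s) x z
    build-adjacent zero h m a≤x z<b = ⊥-elim (<⇒≱ (m<n⇒0<n∸m (nonempty m a≤x z<b)) h)
    build-adjacent (suc f) {a} {b} h = buildSplit-adjacent f h (split a b)
    buildSplit-adjacent f h (empty b≤a) m a≤x z<b = ⊥-elim (<⇒≱ (nonempty m a≤x z<b) b≤a)
    buildSplit-adjacent f {a} {b} h (unmatched _ b≤partner) m a≤x z<b with m≤n⇒m<n∨m≡n a≤x
    ... | inj₂ refl = ⊥-elim (<⇒≱ z<b (b≤partner m))
    ... | inj₁ a<x  = adjacent-right (build-adjacent f (fuel-step a b h) m a<x z<b)
    buildSplit-adjacent f {a} {b} h (matched {y} m₀ a<y y<b) {x} m a≤x z<b with m≤n⇒m<n∨m≡n a≤x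
    ... | inj₂ refl with right-partner-unique matching m₀ m
    ...   | refl = inj₂ (here-l root)
    buildSplit-adjacent f {a} {b} h (matched {y} m₀ a<y y<b) {x} m a≤x z<b | inj₁ a<x with <-cmp x y
    ... | tri< x<y _ _ = adjacent-left (adjacent-right
          (build-adjacent f (fuel-left h a<y y<b) m a<x (nested matching noncrossing m₀ m a<x x<y)))
    ... | tri≈ _ refl _ = ⊥-elim (right-end-not-left-end matching m₀ m)
    ... | tri> _ _ y<x = adjacent-right (build-adjacent f (fuel-right h a<y y<b) m y<x z<b)

lemma10 : (n : ℕ) (M : List Edge) → IsMatching n M → IsNonSelfIntersecting M →
    Σ Tree λ t → IsBSTOn n t × (∀ {x y} → (x , y) ∈ M → Adjacent t x y)
lemma10 n M matching noncrossing =
  build n 1 (suc n) ,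
  (sorted⇒IsBST _ (subst (AllPairs _<_) (sym keys-tree) (interval-sorted 1 (suc n))) ,
   ↭-reflexive (trans keys-tree (sym (oneTo≡consecutive n)))) ,
  λ m → let 1≤x , _ , y≤n = proj₁ matching m
        in build-adjacent matching noncrossing n ≤-refl m 1≤x (s≤s y≤n)
  where
  open Construction (split matching)

  keys-tree : keys (build n 1 (suc n)) ≡ interval 1 (suc n)
  keys-tree = keys-build n ≤-refl
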